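{- Let $p:\mathcal E\to\mathcal I$ be a monoidal closed fibration, $q:\mathcal D\to\mathcal J$ a type refinement system, and $(L\dashv R):p\dashv q$ an adjunction of type refinement systems giving rise to a strong monad on $p$. For every e-type $T\sqsubset B$ of $p$ and every d-type $U\sqsubset C$ of $q$, there is an expression $\xi:R_0L_0B\to (R_0C/B)\backslash R_0C$ with $\eta_B;\xi=\mathrm{shift}_{B,R_0C}$, together with a derivation $\xi_{T,U}$ of the judgment $R_1L_1T\Rightarrow_{\xi}(R_1U/T)\backslash R_1U$ such that $\eta_T;\xi_{T,U}=\Lambda(\mathrm{ev}^r_{R_1U,T})$, where $\mathrm{ev}^r_{R_1U,T}$ is the structural derivation of $(R_1U/T)\otimes T\Rightarrow_{\mathrm{ev}^r}R_1U$ and $\Lambda$ is the left-residual introduction operation (applied with left factor $R_1U/T$), yielding a derivation of $T\Rightarrow_{\mathrm{shift}_{B,R_0C}}(R_1U/T)\backslash R_1U$.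
   Context: A type refinement system is a functor $p:\mathcal E\to\mathcal I$; objects/morphisms of $\mathcal I$ are i-types/expressions, of $\mathcal E$ are e-types/derivations; composition is diagrammatic ($f;g$ = $f$ then $g$). $S\sqsubset A$ means $p(S)=A$. A derivation of $S\Rightarrow_f T$ is a morphism $\alpha:S\to T$ of $\mathcal E$ with $p(\alpha)=f$. For $f:A\to B$, $T\sqsubset B$, a pullback $f^*T\sqsubset A$ is given by a cartesian derivation of $f^*T\Rightarrow_f T$ (every derivation of $S\Rightarrow_{g;f}T$ factors uniquely as a derivation of $S\Rightarrow_g f^*T$ followed by it); a fibration has all pullbacks. $\mathcal I$ is monoidal closed: product $\otimes$, unit $\mathbf 1$, left residual $A\backslash C$ with $\mathrm{ev}^l:A\otimes(A\backslash C)\to C$ and bijection $\lambda:\mathrm{Hom}(A\otimes X,C)\cong\mathrm{Hom}(X,A\backslash C)$ with $(\mathrm{id}\otimes\lambda f);\mathrm{ev}^l=f$, $\lambda((\mathrm{id}\otimes g);\mathrm{ev}^l)=g$; right residual $C/B$ with $\mathrm{ev}^r:(C/B)\otimes B\to C$ and bijection $\rho:\mathrm{Hom}(X\otimes B,C)\cong\mathrm{Hom}(X,C/B)$ satisfying the analogous equations. $\mathrm{shift}_{B,C}:=\lambda(\mathrm{ev}^r):B\to(C/B)\backslash C$. A monoidal closed fibration is a strong monoidal functor $p$ (with $S\otimes T\sqsubset A\otimes B$ for $S\sqsubset A,T\sqsubset B$) having all pullbacks, preserved by $\otimes$, and such that for $S\sqsubset A$, $U\sqsubset C$, $T\sqsubset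 B$ there are e-types $S\backslash U\sqsubset A\backslash C$ and $U/T\sqsubset C/B$ with derivations $\mathrm{ev}^l_{S,U}$ of $S\otimes(S\backslash U)\Rightarrow_{\mathrm{ev}^l}U$ and $\mathrm{ev}^r_{U,T}$ of $(U/T)\otimes T\Rightarrow_{\mathrm{ev}^r}U$, and operations $\Lambda$ (derivations of $S\otimes X\Rightarrow_f U$ to derivations of $X\Rightarrow_{\lambda f}S\backslash U$) and $P$ (derivations of $X\otimes T\Rightarrow_f U$ to derivations of $X\Rightarrow_{\rho f}U/T$) satisfying $(\mathrm{id}\otimes\Lambda\beta);\mathrm{ev}^l_{S,U}=\beta$, $\Lambda((\mathrm{id}\otimes\eta);\mathrm{ev}^l_{S,U})=\eta$, $(P\beta\otimes\mathrm{id});\mathrm{ev}^r_{U,T}=\beta$, $P((\eta\otimes\mathrm{id});\mathrm{ev}^r_{U,T})=\eta$. An adjunction of type refinement systems $(L\dashv R):p\dashv q$, with $q:\mathcal D\to\mathcal J$ (objects of $\mathcal D$ called d-types), consists of functors $L_0:\mathcal I\to\mathcal J$, $L_1:\mathcal E\to\mathcal D$, $R_0:\mathcal J\to\mathcal I$, $R_1:\mathcal D\to\mathcal E$ with $qL_1=L_0p$, $pR_1=R_0q$, adjunctions $L_0\dashv R_0$, $L_1\dashv R_1$ with units $\eta$ and counits $\epsilon$, such that $p(\eta_S)=\eta_{pS}$, $q(\epsilon_T)=\epsilon_{qT}$. It gives rise to a strong monad on $p$ if $R_0L_0$ has a strength $\sigma_{A,B}:A\otimes R_0L_0B\to R_0L_0(A\otimes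 B)$ and $R_1L_1$ a strength $\sigma_{S,T}:S\otimes R_1L_1T\to R_1L_1(S\otimes T)$, both compatible with unit and multiplication, with $p(\sigma_{S,T})=\sigma_{pS,pT}$. -}

module Defs where

open import Level using (Level; _⊔_) renaming (suc to lsuc)
open import Relation.Binary.PropositionalEquality using (_≡_; subst)
open import Data.Product using (Σ; _×_; Σ-syntax)

PathOver : ∀ {a b} {A : Set a} (P : A → Set b) {x y : A} → x ≡ y → P x → P y → Set b
PathOver P e u v = subst P e u ≡ v

-- Categories (composition is diagrammatic: f ⨾ g = f then g)

record Category (o ℓ : Level) : Set (lsuc (o ⊔ ℓ)) where
  infixr 9 _⨾_
  field
    Obj   : Set o
    Hom   : Obj → Obj → Set ℓ
    id    : ∀ {A} → Hom A A
    _⨾_   : ∀ {A B C} → Hom A B → Hom B C → Hom A C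
    idˡ   : ∀ {A B} (f : Hom A B) → id ⨾ f ≡ f
    idʳ   : ∀ {A B} (f : Hom A B) → f ⨾ id ≡ f
    assoc : ∀ {A B C D} (f : Hom A B) (g : Hom B C) (h : Hom C D) →
            (f ⨾ g) ⨾ h ≡ f ⨾ (g ⨾ h)

record Functor {o ℓ o' ℓ'} (C : Category o ℓ) (D : Category o' ℓ') : Set (o ⊔ ℓ ⊔ o' ⊔ ℓ') where
  private
    module C = Category C
    module D = Category D
  field
    F₀     : C.Obj → D.Obj
    F₁     : ∀ {A B} → C.Hom A B → D.Hom (F₀ A) (F₀ B)
    F-id   : ∀ {A} → F₁ (C.id {A}) ≡ D.id
    F-comp : ∀ {A B E} (f : C.Hom A B) (g : C.Hom B E) → F₁ (f C.⨾ g) ≡ F₁ f D.⨾ F₁ g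

record Adjunction {o ℓ o' ℓ'} {C : Category o ℓ} {D : Category o' ℓ'}
                  (F : Functor C D) (G : Functor D C) : Set (o ⊔ ℓ ⊔ o' ⊔ ℓ') where
  private
    module C = Category C
    module D = Category D
    module F = Functor F
    module G = Functor G
  field
    unit   : ∀ A → C.Hom A (G.F₀ (F.F₀ A))
    counit : ∀ X → D.Hom (F.F₀ (G.F₀ X)) X
    unit-nat   : ∀ {A B} (f : C.Hom A B) → f C.⨾ unit B ≡ unit A C.⨾ G.F₁ (F.F₁ f)
    counit-nat : ∀ {X Y} (g : D.Hom X Y) → F.F₁ (G.F₁ g) D.⨾ counit Y ≡ counit X D.⨾ g
    zig : ∀ A → F.F₁ (unit A) D.⨾ counit (F.F₀ A) ≡ D.id
    zag : ∀ X → unit (G.F₀ X) C.⨾ G.F₁ (counit X) ≡ C.id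

record Monoidal {o ℓ} (C : Category o ℓ) : Set (o ⊔ ℓ) where
  open Category C
  infixr 10 _⊗₀_ _⊗₁_
  field
    _⊗₀_ : Obj → Obj → Obj
    _⊗₁_ : ∀ {A B A' B'} → Hom A B → Hom A' B' → Hom (A ⊗₀ A') (B ⊗₀ B')
    ⊗-id   : ∀ {A B} → id {A} ⊗₁ id {B} ≡ id
    ⊗-comp : ∀ {A B E A' B' E'} (f : Hom A B) (g : Hom B E) (f' : Hom A' B') (g' : Hom B' E') →
             (f ⨾ g) ⊗₁ (f' ⨾ g') ≡ (f ⊗₁ f') ⨾ (g ⊗₁ g')
    𝟙 : Obj
    α⇒ : ∀ {A B E} → Hom ((A ⊗₀ B) ⊗₀ E) (A ⊗₀ (B ⊗₀ E))
    α⇐ : ∀ {A B E} → Hom (A ⊗₀ (B ⊗₀ E)) ((A ⊗₀ B) ⊗₀ E)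
    lu⇒ : ∀ {A} → Hom (𝟙 ⊗₀ A) A
    lu⇐ : ∀ {A} → Hom A (𝟙 ⊗₀ A)
    ru⇒ : ∀ {A} → Hom (A ⊗₀ 𝟙) A
    ru⇐ : ∀ {A} → Hom A (A ⊗₀ 𝟙)
    α-iso₁  : ∀ {A B E} → α⇒ {A} {B} {E} ⨾ α⇐ ≡ id
    α-iso₂  : ∀ {A B E} → α⇐ {A} {B} {E} ⨾ α⇒ ≡ id
    lu-iso₁ : ∀ {A} → lu⇒ {A} ⨾ lu⇐ ≡ id
    lu-iso₂ : ∀ {A} → lu⇐ {A} ⨾ lu⇒ ≡ id
    ru-iso₁ : ∀ {A} → ru⇒ {A} ⨾ ru⇐ ≡ id
    ru-iso₂ : ∀ {A} → ru⇐ {A} ⨾ ru⇒ ≡ id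
    α-nat  : ∀ {A B E A' B' E'} (f : Hom A A') (g : Hom B B') (h : Hom E E') →
             ((f ⊗₁ g) ⊗₁ h) ⨾ α⇒ ≡ α⇒ ⨾ (f ⊗₁ (g ⊗₁ h))
    lu-nat : ∀ {A B} (f : Hom A B) → (id ⊗₁ f) ⨾ lu⇒ ≡ lu⇒ ⨾ f
    ru-nat : ∀ {A B} (f : Hom A B) → (f ⊗₁ id) ⨾ ru⇒ ≡ ru⇒ ⨾ f
    pentagon : ∀ {A B E F} →
      (α⇒ {A} {B} {E} ⊗₁ id {F}) ⨾ α⇒ ⨾ (id ⊗₁ α⇒) ≡ α⇒ ⨾ α⇒
    triangle : ∀ {A B} → α⇒ {A} {𝟙} {B} ⨾ (id ⊗₁ lu⇒) ≡ ru⇒ ⊗₁ id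

-- Left residual A ⊸ C  (written A\C in the paper) and
-- right residual C ⟜ B (written C/B in the paper).
record Closed {o ℓ} {C : Category o ℓ} (M : Monoidal C) : Set (o ⊔ ℓ) where
  open Category C
  open Monoidal M
  field
    _⊸_ : Obj → Obj → Obj
    evl : ∀ {A E} → Hom (A ⊗₀ (A ⊸ E)) E
    lam : ∀ {A X E} → Hom (A ⊗₀ X) E → Hom X (A ⊸ E)
    lam-β : ∀ {A X E} (f : Hom (A ⊗₀ X) E) → (id ⊗₁ lam f) ⨾ evl ≡ f
    lam-η : ∀ {A X E} (g : Hom X (A ⊸ E)) → lam ((id ⊗₁ g) ⨾ evl) ≡ g
    _⟜_ : Obj → Obj → Obj
    evr : ∀ {E B} → Hom ((E ⟜ B) ⊗₀ B) E
    rho : ∀ {X B E} → Hom (X ⊗₀ B) E → Hom X (E ⟜ B)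
    rho-β : ∀ {X B E} (f : Hom (X ⊗₀ B) E) → (rho f ⊗₁ id) ⨾ evr ≡ f
    rho-η : ∀ {X B E} (g : Hom X (E ⟜ B)) → rho ((g ⊗₁ id) ⨾ evr) ≡ g

  shift : ∀ B E → Hom B ((E ⟜ B) ⊸ E)
  shift B E = lam (evr {E} {B})

-- Type refinement systems, presented as displayed categories:
-- Ob[ A ] = e-types refining A, Hom[ f ] S T = derivations of S ⇒_f T.
-- (A functor p : E → I is the same data as a displayed category over I,
--  E being its total category.)

record Displayed {o ℓ} (C : Category o ℓ) (o' ℓ' : Level) : Set (o ⊔ ℓ ⊔ lsuc (o' ⊔ ℓ')) where
  open Category C
  infixr 9 _⨾ᵈ_
  field
    Ob[_]  : Obj → Set o'
    Hom[_] : ∀ {A B} → Hom A B → Ob[ A ] → Ob[ B ] → Set ℓ'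
    idᵈ    : ∀ {A} {S : Ob[ A ]} → Hom[ id ] S S
    _⨾ᵈ_   : ∀ {A B E} {f : Hom A B} {g : Hom B E} {S T U} →
             Hom[ f ] S T → Hom[ g ] T U → Hom[ f ⨾ g ] S U
    idˡᵈ : ∀ {A B} {f : Hom A B} {S T} (φ : Hom[ f ] S T) →
           PathOver (λ h → Hom[ h ] S T) (idˡ f) (idᵈ ⨾ᵈ φ) φ
    idʳᵈ : ∀ {A B} {f : Hom A B} {S T} (φ : Hom[ f ] S T) →
           PathOver (λ h → Hom[ h ] S T) (idʳ f) (φ ⨾ᵈ idᵈ) φ
    assocᵈ : ∀ {A B E F} {f : Hom A B} {g : Hom B E} {h : Hom E F} {S T U V}
             (φ : Hom[ f ] S T) (ψ : Hom[ g ] T U) (χ : Hom[ h ] U V) →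
             PathOver (λ k → Hom[ k ] S V) (assoc f g h) ((φ ⨾ᵈ ψ) ⨾ᵈ χ) (φ ⨾ᵈ (ψ ⨾ᵈ χ))

  IsCartesian : ∀ {A B} {f : Hom A B} {S T} → Hom[ f ] S T → Set (o ⊔ ℓ ⊔ o' ⊔ ℓ')
  IsCartesian {A} {B} {f} {S} {T} φ =
    ∀ {X} {g : Hom X A} {R : Ob[ X ]} (β : Hom[ g ⨾ f ] R T) →
    Σ[ γ ∈ Hom[ g ] R S ] ((γ ⨾ᵈ φ ≡ β) × (∀ (γ' : Hom[ g ] R S) → γ' ⨾ᵈ φ ≡ β → γ' ≡ γ))

  record Pullback {A B} (f : Hom A B) (T : Ob[ B ]) : Set (o ⊔ ℓ ⊔ o' ⊔ ℓ') where
    field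
      f*T  : Ob[ A ]
      cart : Hom[ f ] f*T T
      cart-isCartesian : IsCartesian cart

  IsFibration : Set (o ⊔ ℓ ⊔ o' ⊔ ℓ')
  IsFibration = ∀ {A B} (f : Hom A B) (T : Ob[ B ]) → Pullback f T

record DispFunctor {o₁ ℓ₁ o₂ ℓ₂ o₁' ℓ₁' o₂' ℓ₂'} {C : Category o₁ ℓ₁} {D : Category o₂ ℓ₂}
                   (F : Functor C D) (E : Displayed C o₁' ℓ₁') (E' : Displayed D o₂' ℓ₂')
                   : Set (o₁ ⊔ ℓ₁ ⊔ o₁' ⊔ ℓ₁' ⊔ o₂' ⊔ ℓ₂') where
  private
    module C = Category C
    module F = Functor F
    module E = Displayed E
    module E' = Displayed E'
  field
    F₀ᵈ : ∀ {A} → E.Ob[ A ] → E'.Ob[ F.F₀ A ]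
    F₁ᵈ : ∀ {A B} {f : C.Hom A B} {S T} → E.Hom[ f ] S T → E'.Hom[ F.F₁ f ] (F₀ᵈ S) (F₀ᵈ T)
    F-idᵈ : ∀ {A} {S : E.Ob[ A ]} →
            PathOver (λ h → E'.Hom[ h ] (F₀ᵈ S) (F₀ᵈ S)) F.F-id (F₁ᵈ (E.idᵈ {S = S})) E'.idᵈ
    F-compᵈ : ∀ {A B X} {f : C.Hom A B} {g : C.Hom B X} {S T U}
              (φ : E.Hom[ f ] S T) (ψ : E.Hom[ g ] T U) →
              PathOver (λ h → E'.Hom[ h ] (F₀ᵈ S) (F₀ᵈ U)) (F.F-comp f g)
                       (F₁ᵈ (φ E.⨾ᵈ ψ)) (F₁ᵈ φ E'.⨾ᵈ F₁ᵈ ψ)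

record DispAdjunction {o₁ ℓ₁ o₂ ℓ₂ o₁' ℓ₁' o₂' ℓ₂'} {C : Category o₁ ℓ₁} {D : Category o₂ ℓ₂}
                      {F : Functor C D} {G : Functor D C} (adj : Adjunction F G)
                      {E : Displayed C o₁' ℓ₁'} {E' : Displayed D o₂' ℓ₂'}
                      (Fᵈ : DispFunctor F E E') (Gᵈ : DispFunctor G E' E)
                      : Set (o₁ ⊔ ℓ₁ ⊔ o₂ ⊔ ℓ₂ ⊔ o₁' ⊔ ℓ₁' ⊔ o₂' ⊔ ℓ₂') where
  private
    module C = Category C
    module D = Category D
    module E = Displayed E
    module E' = Displayed E'
    module F = Functor F
    module G = Functor G
    module Fᵈ = DispFunctor Fᵈ
    module Gᵈ = DispFunctor Gᵈ
    open Adjunction adj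
  field
    unitᵈ   : ∀ {A} (S : E.Ob[ A ]) → E.Hom[ unit A ] S (Gᵈ.F₀ᵈ (Fᵈ.F₀ᵈ S))
    counitᵈ : ∀ {X} (T : E'.Ob[ X ]) → E'.Hom[ counit X ] (Fᵈ.F₀ᵈ (Gᵈ.F₀ᵈ T)) T
    unit-natᵈ : ∀ {A B} {f : C.Hom A B} {S T} (φ : E.Hom[ f ] S T) →
      PathOver (λ h → E.Hom[ h ] S (Gᵈ.F₀ᵈ (Fᵈ.F₀ᵈ T))) (unit-nat f)
               (φ E.⨾ᵈ unitᵈ T) (unitᵈ S E.⨾ᵈ Gᵈ.F₁ᵈ (Fᵈ.F₁ᵈ φ))
    counit-natᵈ : ∀ {X Y} {g : D.Hom X Y} {S T} (φ : E'.Hom[ g ] S T) →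
      PathOver (λ h → E'.Hom[ h ] (Fᵈ.F₀ᵈ (Gᵈ.F₀ᵈ S)) T) (counit-nat g)
               (Fᵈ.F₁ᵈ (Gᵈ.F₁ᵈ φ) E'.⨾ᵈ counitᵈ T) (counitᵈ S E'.⨾ᵈ φ)
    zigᵈ : ∀ {A} (S : E.Ob[ A ]) →
      PathOver (λ h → E'.Hom[ h ] (Fᵈ.F₀ᵈ S) (Fᵈ.F₀ᵈ S)) (zig A)
               (Fᵈ.F₁ᵈ (unitᵈ S) E'.⨾ᵈ counitᵈ (Fᵈ.F₀ᵈ S)) E'.idᵈ
    zagᵈ : ∀ {X} (T : E'.Ob[ X ]) →
      PathOver (λ h → E.Hom[ h ] (Gᵈ.F₀ᵈ T) (Gᵈ.F₀ᵈ T)) (zag X)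
               (unitᵈ (Gᵈ.F₀ᵈ T) E.⨾ᵈ Gᵈ.F₁ᵈ (counitᵈ T)) E.idᵈ

-- Monoidal structure on a type refinement system p : E → I making p a
-- (strict) strong monoidal functor: S ⊗ T ⊏ A ⊗ B, 𝟙ᵈ ⊏ 𝟙, and the
-- structural derivations of E lie over the structural maps of I.

record DispMonoidal {o ℓ o' ℓ'} {C : Category o ℓ} (E : Displayed C o' ℓ') (M : Monoidal C)
                    : Set (o ⊔ ℓ ⊔ o' ⊔ ℓ') where
  open Category C
  open Monoidal M
  open Displayed E
  infixr 10 _⊗ᵈ_ _⊗₁ᵈ_
  field
    _⊗ᵈ_  : ∀ {A B} → Ob[ A ] → Ob[ B ] → Ob[ A ⊗₀ B ]
    _⊗₁ᵈ_ : ∀ {A B A' B'} {f : Hom A B} {f' : Hom A' B'} {S T S' T'} →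
            Hom[ f ] S T → Hom[ f' ] S' T' → Hom[ f ⊗₁ f' ] (S ⊗ᵈ S') (T ⊗ᵈ T')
    ⊗ᵈ-id : ∀ {A B} {S : Ob[ A ]} {T : Ob[ B ]} →
            PathOver (λ h → Hom[ h ] (S ⊗ᵈ T) (S ⊗ᵈ T)) ⊗-id (idᵈ {S = S} ⊗₁ᵈ idᵈ {S = T}) idᵈ
    ⊗ᵈ-comp : ∀ {A B X A' B' X'} {f : Hom A B} {g : Hom B X} {f' : Hom A' B'} {g' : Hom B' X'}
              {S T U S' T' U'} (φ : Hom[ f ] S T) (ψ : Hom[ g ] T U)
              (φ' : Hom[ f' ] S' T') (ψ' : Hom[ g' ] T' U') →
              PathOver (λ h → Hom[ h ] (S ⊗ᵈ S') (U ⊗ᵈ U')) (⊗-comp f g f' g')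
                       ((φ ⨾ᵈ ψ) ⊗₁ᵈ (φ' ⨾ᵈ ψ')) ((φ ⊗₁ᵈ φ') ⨾ᵈ (ψ ⊗₁ᵈ ψ'))
    𝟙ᵈ : Ob[ 𝟙 ]
    α⇒ᵈ : ∀ {A B X} {S : Ob[ A ]} {T : Ob[ B ]} {U : Ob[ X ]} →
          Hom[ α⇒ ] ((S ⊗ᵈ T) ⊗ᵈ U) (S ⊗ᵈ (T ⊗ᵈ U))
    α⇐ᵈ : ∀ {A B X} {S : Ob[ A ]} {T : Ob[ B ]} {U : Ob[ X ]} →
          Hom[ α⇐ ] (S ⊗ᵈ (T ⊗ᵈ U)) ((S ⊗ᵈ T) ⊗ᵈ U)
    lu⇒ᵈ : ∀ {A} {S : Ob[ A ]} → Hom[ lu⇒ ] (𝟙ᵈ ⊗ᵈ S) S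
    lu⇐ᵈ : ∀ {A} {S : Ob[ A ]} → Hom[ lu⇐ ] S (𝟙ᵈ ⊗ᵈ S)
    ru⇒ᵈ : ∀ {A} {S : Ob[ A ]} → Hom[ ru⇒ ] (S ⊗ᵈ 𝟙ᵈ) S
    ru⇐ᵈ : ∀ {A} {S : Ob[ A ]} → Hom[ ru⇐ ] S (S ⊗ᵈ 𝟙ᵈ)
    α-iso₁ᵈ : ∀ {A B X} {S : Ob[ A ]} {T : Ob[ B ]} {U : Ob[ X ]} →
      PathOver (λ h → Hom[ h ] ((S ⊗ᵈ T) ⊗ᵈ U) ((S ⊗ᵈ T) ⊗ᵈ U)) α-iso₁ (α⇒ᵈ ⨾ᵈ α⇐ᵈ) idᵈ
    α-iso₂ᵈ : ∀ {A B X} {S : Ob[ A ]} {T : Ob[ B ]} {U : Ob[ X ]} →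
      PathOver (λ h → Hom[ h ] (S ⊗ᵈ (T ⊗ᵈ U)) (S ⊗ᵈ (T ⊗ᵈ U))) α-iso₂ (α⇐ᵈ ⨾ᵈ α⇒ᵈ) idᵈ
    lu-iso₁ᵈ : ∀ {A} {S : Ob[ A ]} →
      PathOver (λ h → Hom[ h ] (𝟙ᵈ ⊗ᵈ S) (𝟙ᵈ ⊗ᵈ S)) lu-iso₁ (lu⇒ᵈ ⨾ᵈ lu⇐ᵈ) idᵈ
    lu-iso₂ᵈ : ∀ {A} {S : Ob[ A ]} →
      PathOver (λ h → Hom[ h ] S S) lu-iso₂ (lu⇐ᵈ ⨾ᵈ lu⇒ᵈ) idᵈ
    ru-iso₁ᵈ : ∀ {A} {S : Ob[ A ]} →
      PathOver (λ h → Hom[ h ] (S ⊗ᵈ 𝟙ᵈ) (S ⊗ᵈ 𝟙ᵈ)) ru-iso₁ (ru⇒ᵈ ⨾ᵈ ru⇐ᵈ) idᵈ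
    ru-iso₂ᵈ : ∀ {A} {S : Ob[ A ]} →
      PathOver (λ h → Hom[ h ] S S) ru-iso₂ (ru⇐ᵈ ⨾ᵈ ru⇒ᵈ) idᵈ
    α-natᵈ : ∀ {A B X A' B' X'} {f : Hom A A'} {g : Hom B B'} {h : Hom X X'}
             {S S' T T' U U'} (φ : Hom[ f ] S S') (ψ : Hom[ g ] T T') (χ : Hom[ h ] U U') →
      PathOver (λ k → Hom[ k ] ((S ⊗ᵈ T) ⊗ᵈ U) (S' ⊗ᵈ (T' ⊗ᵈ U'))) (α-nat f g h)
               (((φ ⊗₁ᵈ ψ) ⊗₁ᵈ χ) ⨾ᵈ α⇒ᵈ) (α⇒ᵈ ⨾ᵈ (φ ⊗₁ᵈ (ψ ⊗₁ᵈ χ)))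
    lu-natᵈ : ∀ {A B} {f : Hom A B} {S T} (φ : Hom[ f ] S T) →
      PathOver (λ k → Hom[ k ] (𝟙ᵈ ⊗ᵈ S) T) (lu-nat f) ((idᵈ ⊗₁ᵈ φ) ⨾ᵈ lu⇒ᵈ) (lu⇒ᵈ ⨾ᵈ φ)
    ru-natᵈ : ∀ {A B} {f : Hom A B} {S T} (φ : Hom[ f ] S T) →
      PathOver (λ k → Hom[ k ] (S ⊗ᵈ 𝟙ᵈ) T) (ru-nat f) ((φ ⊗₁ᵈ idᵈ) ⨾ᵈ ru⇒ᵈ) (ru⇒ᵈ ⨾ᵈ φ)
    pentagonᵈ : ∀ {A B X Y} {S : Ob[ A ]} {T : Ob[ B ]} {U : Ob[ X ]} {V : Ob[ Y ]} →
      PathOver (λ k → Hom[ k ] (((S ⊗ᵈ T) ⊗ᵈ U) ⊗ᵈ V) (S ⊗ᵈ (T ⊗ᵈ (U ⊗ᵈ V)))) pentagon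
               ((α⇒ᵈ ⊗₁ᵈ idᵈ) ⨾ᵈ α⇒ᵈ ⨾ᵈ (idᵈ ⊗₁ᵈ α⇒ᵈ)) (α⇒ᵈ ⨾ᵈ α⇒ᵈ)
    triangleᵈ : ∀ {A B} {S : Ob[ A ]} {T : Ob[ B ]} →
      PathOver (λ k → Hom[ k ] ((S ⊗ᵈ 𝟙ᵈ) ⊗ᵈ T) (S ⊗ᵈ T)) triangle
               (α⇒ᵈ ⨾ᵈ (idᵈ ⊗₁ᵈ lu⇒ᵈ)) (ru⇒ᵈ ⊗₁ᵈ idᵈ)

  ⊗PreservesCartesian : Set (o ⊔ ℓ ⊔ o' ⊔ ℓ')
  ⊗PreservesCartesian =
    ∀ {A B A' B'} {f : Hom A B} {f' : Hom A' B'} {S T S' T'}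
      (φ : Hom[ f ] S T) (φ' : Hom[ f' ] S' T') →
      IsCartesian φ → IsCartesian φ' → IsCartesian (φ ⊗₁ᵈ φ')

record DispClosed {o ℓ o' ℓ'} {C : Category o ℓ} {E : Displayed C o' ℓ'} {M : Monoidal C}
                  (ME : DispMonoidal E M) (CM : Closed M) : Set (o ⊔ ℓ ⊔ o' ⊔ ℓ') where
  open Category C
  open Monoidal M
  open Closed CM
  open Displayed E
  open DispMonoidal ME
  field
    _⊸ᵈ_ : ∀ {A X} → Ob[ A ] → Ob[ X ] → Ob[ A ⊸ X ]
    evlᵈ : ∀ {A X} {S : Ob[ A ]} {U : Ob[ X ]} → Hom[ evl ] (S ⊗ᵈ (S ⊸ᵈ U)) U
    Lam  : ∀ {A Y X} {f : Hom (A ⊗₀ Y) X} {S : Ob[ A ]} {R : Ob[ Y ]} {U : Ob[ X ]} →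
           Hom[ f ] (S ⊗ᵈ R) U → Hom[ lam f ] R (S ⊸ᵈ U)
    Lam-β : ∀ {A Y X} {f : Hom (A ⊗₀ Y) X} {S : Ob[ A ]} {R : Ob[ Y ]} {U : Ob[ X ]}
            (β : Hom[ f ] (S ⊗ᵈ R) U) →
            PathOver (λ h → Hom[ h ] (S ⊗ᵈ R) U) (lam-β f) ((idᵈ ⊗₁ᵈ Lam β) ⨾ᵈ evlᵈ) β
    Lam-η : ∀ {A Y X} {g : Hom Y (A ⊸ X)} {S : Ob[ A ]} {R : Ob[ Y ]} {U : Ob[ X ]}
            (η : Hom[ g ] R (S ⊸ᵈ U)) →
            PathOver (λ h → Hom[ h ] R (S ⊸ᵈ U)) (lam-η g) (Lam ((idᵈ ⊗₁ᵈ η) ⨾ᵈ evlᵈ)) η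
    _⟜ᵈ_ : ∀ {X B} → Ob[ X ] → Ob[ B ] → Ob[ X ⟜ B ]
    evrᵈ : ∀ {X B} {U : Ob[ X ]} {T : Ob[ B ]} → Hom[ evr ] ((U ⟜ᵈ T) ⊗ᵈ T) U
    Rho  : ∀ {Y B X} {f : Hom (Y ⊗₀ B) X} {R : Ob[ Y ]} {T : Ob[ B ]} {U : Ob[ X ]} →
           Hom[ f ] (R ⊗ᵈ T) U → Hom[ rho f ] R (U ⟜ᵈ T)
    Rho-β : ∀ {Y B X} {f : Hom (Y ⊗₀ B) X} {R : Ob[ Y ]} {T : Ob[ B ]} {U : Ob[ X ]}
            (β : Hom[ f ] (R ⊗ᵈ T) U) →
            PathOver (λ h → Hom[ h ] (R ⊗ᵈ T) U) (rho-β f) ((Rho β ⊗₁ᵈ idᵈ) ⨾ᵈ evrᵈ) β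
    Rho-η : ∀ {Y B X} {g : Hom Y (X ⟜ B)} {R : Ob[ Y ]} {T : Ob[ B ]} {U : Ob[ X ]}
            (η : Hom[ g ] R (U ⟜ᵈ T)) →
            PathOver (λ h → Hom[ h ] R (U ⟜ᵈ T)) (rho-η g) (Rho ((η ⊗₁ᵈ idᵈ) ⨾ᵈ evrᵈ)) η

record MonoidalClosedFibration {o ℓ} {I : Category o ℓ} {MI : Monoidal I} (CI : Closed MI)
                               (o' ℓ' : Level) : Set (o ⊔ ℓ ⊔ lsuc (o' ⊔ ℓ')) where
  field
    E        : Displayed I o' ℓ'
    ME       : DispMonoidal E MI
    fibration : Displayed.IsFibration E
    ⊗-cart   : DispMonoidal.⊗PreservesCartesian ME
    CE       : DispClosed ME CI

record TRSAdjunction {o₁ ℓ₁ o₂ ℓ₂ o₁' ℓ₁' o₂' ℓ₂'} {I : Category o₁ ℓ₁} {J : Category o₂ ℓ₂}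
                     (E : Displayed I o₁' ℓ₁') (D : Displayed J o₂' ℓ₂')
                     : Set (o₁ ⊔ ℓ₁ ⊔ o₂ ⊔ ℓ₂ ⊔ o₁' ⊔ ℓ₁' ⊔ o₂' ⊔ ℓ₂') where
  field
    L₀ : Functor I J
    R₀ : Functor J I
    L₁ : DispFunctor L₀ E D
    R₁ : DispFunctor R₀ D E
    adj₀ : Adjunction L₀ R₀
    adj₁ : DispAdjunction adj₀ L₁ R₁

record StrongMonadOn {o₁ ℓ₁ o₂ ℓ₂ o₁' ℓ₁' o₂' ℓ₂'} {I : Category o₁ ℓ₁} {MI : Monoidal I}
                     {CI : Closed MI} {J : Category o₂ ℓ₂}
                     (p : MonoidalClosedFibration CI o₁' ℓ₁') {D : Displayed J o₂' ℓ₂'}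
                     (LR : TRSAdjunction (MonoidalClosedFibration.E p) D)
                     : Set (o₁ ⊔ ℓ₁ ⊔ o₂ ⊔ ℓ₂ ⊔ o₁' ⊔ ℓ₁' ⊔ o₂' ⊔ ℓ₂') where
  open Category I
  open Monoidal MI
  open MonoidalClosedFibration p
  open Displayed E
  open DispMonoidal ME
  open TRSAdjunction LR
  private
    module L₀ = Functor L₀
    module R₀ = Functor R₀
    module L₁ = DispFunctor L₁
    module R₁ = DispFunctor R₁
    open Adjunction adj₀
    open DispAdjunction adj₁

  T₀ : Obj → Obj
  T₀ A = R₀.F₀ (L₀.F₀ A)
  T₁ : ∀ {A B} → Hom A B → Hom (T₀ A) (T₀ B)
  T₁ f = R₀.F₁ (L₀.F₁ f)
  μ : ∀ A → Hom (T₀ (T₀ A)) (T₀ A)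
  μ A = R₀.F₁ (counit (L₀.F₀ A))
  T₀ᵈ : ∀ {A} → Ob[ A ] → Ob[ T₀ A ]
  T₀ᵈ S = R₁.F₀ᵈ (L₁.F₀ᵈ S)
  T₁ᵈ : ∀ {A B} {f : Hom A B} {S T} → Hom[ f ] S T → Hom[ T₁ f ] (T₀ᵈ S) (T₀ᵈ T)
  T₁ᵈ φ = R₁.F₁ᵈ (L₁.F₁ᵈ φ)
  μᵈ : ∀ {A} (S : Ob[ A ]) → Hom[ μ A ] (T₀ᵈ (T₀ᵈ S)) (T₀ᵈ S)
  μᵈ S = R₁.F₁ᵈ (counitᵈ (L₁.F₀ᵈ S))

  field
    σ : ∀ A B → Hom (A ⊗₀ T₀ B) (T₀ (A ⊗₀ B))
    σ-nat : ∀ {A A' B B'} (f : Hom A A') (g : Hom B B') →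
            (f ⊗₁ T₁ g) ⨾ σ A' B' ≡ σ A B ⨾ T₁ (f ⊗₁ g)
    σ-lu  : ∀ B → σ 𝟙 B ⨾ T₁ lu⇒ ≡ lu⇒
    σ-α   : ∀ A B X → σ (A ⊗₀ B) X ⨾ T₁ α⇒ ≡ α⇒ ⨾ (id ⊗₁ σ B X) ⨾ σ A (B ⊗₀ X)
    σ-unit : ∀ A B → (id ⊗₁ unit B) ⨾ σ A B ≡ unit (A ⊗₀ B)
    σ-mult : ∀ A B → (id ⊗₁ μ B) ⨾ σ A B ≡ σ A (T₀ B) ⨾ T₁ (σ A B) ⨾ μ (A ⊗₀ B)
    σᵈ : ∀ {A B} (S : Ob[ A ]) (T : Ob[ B ]) → Hom[ σ A B ] (S ⊗ᵈ T₀ᵈ T) (T₀ᵈ (S ⊗ᵈ T))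
    σ-natᵈ : ∀ {A A' B B'} {f : Hom A A'} {g : Hom B B'} {S S' T T'}
             (φ : Hom[ f ] S S') (ψ : Hom[ g ] T T') →
      PathOver (λ h → Hom[ h ] (S ⊗ᵈ T₀ᵈ T) (T₀ᵈ (S' ⊗ᵈ T'))) (σ-nat f g)
               ((φ ⊗₁ᵈ T₁ᵈ ψ) ⨾ᵈ σᵈ S' T') (σᵈ S T ⨾ᵈ T₁ᵈ (φ ⊗₁ᵈ ψ))
    σ-luᵈ : ∀ {B} (T : Ob[ B ]) →
      PathOver (λ h → Hom[ h ] (𝟙ᵈ ⊗ᵈ T₀ᵈ T) (T₀ᵈ T)) (σ-lu B)
               (σᵈ 𝟙ᵈ T ⨾ᵈ T₁ᵈ lu⇒ᵈ) lu⇒ᵈ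
    σ-αᵈ : ∀ {A B X} (S : Ob[ A ]) (T : Ob[ B ]) (U : Ob[ X ]) →
      PathOver (λ h → Hom[ h ] ((S ⊗ᵈ T) ⊗ᵈ T₀ᵈ U) (T₀ᵈ (S ⊗ᵈ (T ⊗ᵈ U)))) (σ-α A B X)
               (σᵈ (S ⊗ᵈ T) U ⨾ᵈ T₁ᵈ α⇒ᵈ) (α⇒ᵈ ⨾ᵈ (idᵈ ⊗₁ᵈ σᵈ T U) ⨾ᵈ σᵈ S (T ⊗ᵈ U))
    σ-unitᵈ : ∀ {A B} (S : Ob[ A ]) (T : Ob[ B ]) →
      PathOver (λ h → Hom[ h ] (S ⊗ᵈ T) (T₀ᵈ (S ⊗ᵈ T))) (σ-unit A B)
               ((idᵈ ⊗₁ᵈ unitᵈ T) ⨾ᵈ σᵈ S T) (unitᵈ (S ⊗ᵈ T))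
    σ-multᵈ : ∀ {A B} (S : Ob[ A ]) (T : Ob[ B ]) →
      PathOver (λ h → Hom[ h ] (S ⊗ᵈ T₀ᵈ (T₀ᵈ T)) (T₀ᵈ (S ⊗ᵈ T))) (σ-mult A B)
               ((idᵈ ⊗₁ᵈ μᵈ T) ⨾ᵈ σᵈ S T) (σᵈ S (T₀ᵈ T) ⨾ᵈ T₁ᵈ (σᵈ S T) ⨾ᵈ μᵈ (S ⊗ᵈ T))

module Submission where

-- Write T₀ = R₀L₀ for the monad on I, T₀ᵈ = R₁L₁ for the monad
-- on E.  Every object R₀C is a T₀-algebra with structure map R₀(ε_C), so a
-- map f : A ⊗ B → R₀C extends along the strength to
--     ext f = σ ⨾ T₀ f ⨾ R₀ ε_C : A ⊗ T₀B → R₀C,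
-- and the unit law of the strength together with naturality of η and the
-- triangle identity give (id ⊗ η_B) ⨾ ext f = f.  By naturality of λ in its
-- parameter, η_B ⨾ λ(ext f) = λ f.  Taking f = evʳ yields ξ = λ(ext evʳ) with
-- η_B ⨾ ξ = λ(evʳ) = shift.  The same argument, verbatim, works one level up
-- for derivations (σᵈ, unitᵈ, counitᵈ, Lam) and gives ξ_{T,U} = Lam(extᵈ evrᵈ).

open import Defs
open import Level using (Level; _⊔_)
open import Relation.Binary.PropositionalEquality using (_≡_; refl; sym; cong; module ≡-Reasoning)
open import Data.Product using (Σ; Σ-syntax; _,_)

-- Derivations over different expressions are compared as elements of the
-- total hom-set Σ f. Hom[ f ] S T; this turns PathOver reasoning into
-- ordinary equational reasoning, and back at the end.
module TotalEquality {o ℓ o' ℓ'} {I : Category o ℓ} (E : Displayed I o' ℓ') where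
  open Category I
  open Displayed E

  infix 4 _≈_
  _≈_ : ∀ {A B} {S : Ob[ A ]} {T : Ob[ B ]} {f g : Hom A B} →
        Hom[ f ] S T → Hom[ g ] S T → Set (ℓ ⊔ ℓ')
  _≈_ {A} {B} {S} {T} u v = _≡_ {A = Σ (Hom A B) (λ h → Hom[ h ] S T)} (_ , u) (_ , v)

  pathOver⇒≈ : ∀ {A B} {S : Ob[ A ]} {T : Ob[ B ]} {f g : Hom A B} {e : f ≡ g}
               {u : Hom[ f ] S T} {v : Hom[ g ] S T} →
               PathOver (λ h → Hom[ h ] S T) e u v → u ≈ v
  pathOver⇒≈ {e = refl} refl = refl

  -- Conversely a total equality yields a PathOver over any given base
  -- equality between the same expressions (by uniqueness of identity proofs).
  ≈⇒pathOver : ∀ {A B} {S : Ob[ A ]} {T : Ob[ B ]} {f g : Hom A B} (e : f ≡ g)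
               {u : Hom[ f ] S T} {v : Hom[ g ] S T} →
               u ≈ v → PathOver (λ h → Hom[ h ] S T) e u v
  ≈⇒pathOver refl refl = refl

  ≈-sym : ∀ {A B} {S : Ob[ A ]} {T : Ob[ B ]} {f g : Hom A B}
          {u : Hom[ f ] S T} {v : Hom[ g ] S T} → u ≈ v → v ≈ u
  ≈-sym refl = refl

  ⨾ᵈ-cong : ∀ {A B X} {S : Ob[ A ]} {T : Ob[ B ]} {U : Ob[ X ]}
            {f f' : Hom A B} {g g' : Hom B X}
            {u : Hom[ f ] S T} {u' : Hom[ f' ] S T} {v : Hom[ g ] T U} {v' : Hom[ g' ] T U} →
            u ≈ u' → v ≈ v' → u ⨾ᵈ v ≈ u' ⨾ᵈ v'
  ⨾ᵈ-cong refl refl = refl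

  assoc≈ : ∀ {A B X Y} {f : Hom A B} {g : Hom B X} {h : Hom X Y} {S T U V}
           (φ : Hom[ f ] S T) (ψ : Hom[ g ] T U) (χ : Hom[ h ] U V) →
           (φ ⨾ᵈ ψ) ⨾ᵈ χ ≈ φ ⨾ᵈ (ψ ⨾ᵈ χ)
  assoc≈ φ ψ χ = pathOver⇒≈ (assocᵈ φ ψ χ)

  idˡ≈ : ∀ {A B} {f : Hom A B} {S T} (φ : Hom[ f ] S T) → idᵈ ⨾ᵈ φ ≈ φ
  idˡ≈ φ = pathOver⇒≈ (idˡᵈ φ)

  idʳ≈ : ∀ {A B} {f : Hom A B} {S T} (φ : Hom[ f ] S T) → φ ⨾ᵈ idᵈ ≈ φ
  idʳ≈ φ = pathOver⇒≈ (idʳᵈ φ)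

module ClosedProperties {o ℓ} {I : Category o ℓ} {MI : Monoidal I} (CI : Closed MI) where
  open Category I
  open Monoidal MI
  open Closed CI
  open ≡-Reasoning

  lam-natural : ∀ {A X Y Z} (g : Hom X Y) (f : Hom (A ⊗₀ Y) Z) →
                g ⨾ lam f ≡ lam ((id ⊗₁ g) ⨾ f)
  lam-natural g f = sym (begin
    lam ((id ⊗₁ g) ⨾ f)                        ≡⟨ cong (λ k → lam ((id ⊗₁ g) ⨾ k)) (sym (lam-β f)) ⟩
    lam ((id ⊗₁ g) ⨾ (id ⊗₁ lam f) ⨾ evl)      ≡⟨ cong lam (sym (assoc _ _ _)) ⟩
    lam (((id ⊗₁ g) ⨾ (id ⊗₁ lam f)) ⨾ evl)    ≡⟨ cong (λ k → lam (k ⨾ evl)) (sym (⊗-comp _ _ _ _)) ⟩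
    lam (((id ⨾ id) ⊗₁ (g ⨾ lam f)) ⨾ evl)     ≡⟨ cong (λ k → lam ((k ⊗₁ (g ⨾ lam f)) ⨾ evl)) (idˡ id) ⟩
    lam ((id ⊗₁ (g ⨾ lam f)) ⨾ evl)            ≡⟨ lam-η _ ⟩
    g ⨾ lam f                                  ∎)

module DispClosedProperties {o ℓ o' ℓ'} {I : Category o ℓ} {MI : Monoidal I} {CI : Closed MI}
    {E : Displayed I o' ℓ'} {ME : DispMonoidal E MI} (CE : DispClosed ME CI) where
  open Category I
  open Monoidal MI
  open Displayed E
  open DispMonoidal ME
  open DispClosed CE
  open TotalEquality E
  open ≡-Reasoning

  ⊗₁ᵈ-cong : ∀ {A₁ B₁ A₂ B₂} {f f' : Hom A₁ B₁} {g g' : Hom A₂ B₂} {S T S' T'}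
             {u : Hom[ f ] S T} {u' : Hom[ f' ] S T} {v : Hom[ g ] S' T'} {v' : Hom[ g' ] S' T'} →
             u ≈ u' → v ≈ v' → u ⊗₁ᵈ v ≈ u' ⊗₁ᵈ v'
  ⊗₁ᵈ-cong refl refl = refl

  Lam-cong : ∀ {A Y X} {f f' : Hom (A ⊗₀ Y) X} {S : Ob[ A ]} {R : Ob[ Y ]} {U : Ob[ X ]}
             {u : Hom[ f ] (S ⊗ᵈ R) U} {v : Hom[ f' ] (S ⊗ᵈ R) U} → u ≈ v → Lam u ≈ Lam v
  Lam-cong refl = refl

  Lam-natural : ∀ {A X Y Z} {g : Hom X Y} {f : Hom (A ⊗₀ Y) Z}
                {S : Ob[ A ]} {Q : Ob[ X ]} {R : Ob[ Y ]} {V : Ob[ Z ]}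
                (γ : Hom[ g ] Q R) (φ : Hom[ f ] (S ⊗ᵈ R) V) →
                γ ⨾ᵈ Lam φ ≈ Lam ((idᵈ ⊗₁ᵈ γ) ⨾ᵈ φ)
  Lam-natural γ φ = ≈-sym (begin
    _ , Lam ((idᵈ ⊗₁ᵈ γ) ⨾ᵈ φ)
      ≡⟨ Lam-cong (⨾ᵈ-cong refl (≈-sym (pathOver⇒≈ (Lam-β φ)))) ⟩
    _ , Lam ((idᵈ ⊗₁ᵈ γ) ⨾ᵈ (idᵈ ⊗₁ᵈ Lam φ) ⨾ᵈ evlᵈ)
      ≡⟨ Lam-cong (≈-sym (assoc≈ _ _ _)) ⟩
    _ , Lam (((idᵈ ⊗₁ᵈ γ) ⨾ᵈ (idᵈ ⊗₁ᵈ Lam φ)) ⨾ᵈ evlᵈ)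
      ≡⟨ Lam-cong (⨾ᵈ-cong (≈-sym (pathOver⇒≈ (⊗ᵈ-comp _ _ _ _))) refl) ⟩
    _ , Lam (((idᵈ ⨾ᵈ idᵈ) ⊗₁ᵈ (γ ⨾ᵈ Lam φ)) ⨾ᵈ evlᵈ)
      ≡⟨ Lam-cong (⨾ᵈ-cong (⊗₁ᵈ-cong (idˡ≈ idᵈ) refl) refl) ⟩
    _ , Lam ((idᵈ ⊗₁ᵈ (γ ⨾ᵈ Lam φ)) ⨾ᵈ evlᵈ)
      ≡⟨ pathOver⇒≈ (Lam-η _) ⟩
    _ , (γ ⨾ᵈ Lam φ)
      ∎)

-- The strong extension of a map into R₀C (resp. a derivation into R₁U),
-- using that R₀C is a T₀-algebra via R₀ε, and its unit law.
module StrongExtension {o₁ ℓ₁ o₂ ℓ₂ o₁' ℓ₁' o₂' ℓ₂' : Level}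
    {I : Category o₁ ℓ₁} {MI : Monoidal I} {CI : Closed MI}
    (p : MonoidalClosedFibration CI o₁' ℓ₁')
    {J : Category o₂ ℓ₂} (q : Displayed J o₂' ℓ₂')
    (LR : TRSAdjunction (MonoidalClosedFibration.E p) q)
    (SM : StrongMonadOn p LR) where
  open Category I
  open Monoidal MI
  open Closed CI
  open MonoidalClosedFibration p
  open Displayed E
  open DispMonoidal ME
  open DispClosed CE
  open TRSAdjunction LR
  private
    module R₀ = Functor R₀
    module R₁ = DispFunctor R₁
  open Adjunction adj₀
  open DispAdjunction adj₁
  open StrongMonadOn SM
  open TotalEquality E
  open ClosedProperties CI
  open DispClosedProperties CE
  open ≡-Reasoning

  ext : ∀ {A B C} → Hom (A ⊗₀ B) (R₀.F₀ C) → Hom (A ⊗₀ T₀ B) (R₀.F₀ C)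
  ext {A} {B} {C} f = σ A B ⨾ T₁ f ⨾ R₀.F₁ (counit C)

  -- strength unit law, naturality of η, and the triangle identity R₀ε ∘ ηR₀ = id
  ext-unit : ∀ {A B C} (f : Hom (A ⊗₀ B) (R₀.F₀ C)) → (id ⊗₁ unit B) ⨾ ext f ≡ f
  ext-unit {A} {B} {C} f = begin
    (id ⊗₁ unit B) ⨾ σ A B ⨾ T₁ f ⨾ R₀.F₁ (counit C)   ≡⟨ sym (assoc _ _ _) ⟩
    ((id ⊗₁ unit B) ⨾ σ A B) ⨾ T₁ f ⨾ R₀.F₁ (counit C) ≡⟨ cong (_⨾ T₁ f ⨾ R₀.F₁ (counit C)) (σ-unit A B) ⟩
    unit (A ⊗₀ B) ⨾ T₁ f ⨾ R₀.F₁ (counit C)            ≡⟨ sym (assoc _ _ _) ⟩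
    (unit (A ⊗₀ B) ⨾ T₁ f) ⨾ R₀.F₁ (counit C)          ≡⟨ cong (_⨾ R₀.F₁ (counit C)) (sym (unit-nat f)) ⟩
    (f ⨾ unit (R₀.F₀ C)) ⨾ R₀.F₁ (counit C)            ≡⟨ assoc _ _ _ ⟩
    f ⨾ unit (R₀.F₀ C) ⨾ R₀.F₁ (counit C)              ≡⟨ cong (f ⨾_) (zag C) ⟩
    f ⨾ id                                             ≡⟨ idʳ f ⟩
    f                                                  ∎

  lam-ext-unit : ∀ {A B C} (f : Hom (A ⊗₀ B) (R₀.F₀ C)) → unit B ⨾ lam (ext f) ≡ lam f
  lam-ext-unit f = begin
    unit _ ⨾ lam (ext f)          ≡⟨ lam-natural _ _ ⟩
    lam ((id ⊗₁ unit _) ⨾ ext f)  ≡⟨ cong lam (ext-unit f) ⟩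
    lam f                         ∎

  extᵈ : ∀ {A B C} {f : Hom (A ⊗₀ B) (R₀.F₀ C)} {S : Ob[ A ]} {T : Ob[ B ]}
         {U : Displayed.Ob[_] q C} →
         Hom[ f ] (S ⊗ᵈ T) (R₁.F₀ᵈ U) → Hom[ ext f ] (S ⊗ᵈ T₀ᵈ T) (R₁.F₀ᵈ U)
  extᵈ {S = S} {T} {U} φ = σᵈ S T ⨾ᵈ T₁ᵈ φ ⨾ᵈ R₁.F₁ᵈ (counitᵈ U)

  extᵈ-unit : ∀ {A B C} {f : Hom (A ⊗₀ B) (R₀.F₀ C)} {S : Ob[ A ]} {T : Ob[ B ]}
              {U : Displayed.Ob[_] q C} (φ : Hom[ f ] (S ⊗ᵈ T) (R₁.F₀ᵈ U)) →
              (idᵈ ⊗₁ᵈ unitᵈ T) ⨾ᵈ extᵈ φ ≈ φ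
  extᵈ-unit {S = S} {T} {U} φ = begin
    _ , (idᵈ ⊗₁ᵈ unitᵈ T) ⨾ᵈ σᵈ S T ⨾ᵈ T₁ᵈ φ ⨾ᵈ R₁.F₁ᵈ (counitᵈ U)
      ≡⟨ ≈-sym (assoc≈ _ _ _) ⟩
    _ , ((idᵈ ⊗₁ᵈ unitᵈ T) ⨾ᵈ σᵈ S T) ⨾ᵈ T₁ᵈ φ ⨾ᵈ R₁.F₁ᵈ (counitᵈ U)
      ≡⟨ ⨾ᵈ-cong (pathOver⇒≈ (σ-unitᵈ S T)) refl ⟩
    _ , unitᵈ (S ⊗ᵈ T) ⨾ᵈ T₁ᵈ φ ⨾ᵈ R₁.F₁ᵈ (counitᵈ U)
      ≡⟨ ≈-sym (assoc≈ _ _ _) ⟩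
    _ , (unitᵈ (S ⊗ᵈ T) ⨾ᵈ T₁ᵈ φ) ⨾ᵈ R₁.F₁ᵈ (counitᵈ U)
      ≡⟨ ⨾ᵈ-cong (≈-sym (pathOver⇒≈ (unit-natᵈ φ))) refl ⟩
    _ , (φ ⨾ᵈ unitᵈ (R₁.F₀ᵈ U)) ⨾ᵈ R₁.F₁ᵈ (counitᵈ U)
      ≡⟨ assoc≈ _ _ _ ⟩
    _ , φ ⨾ᵈ unitᵈ (R₁.F₀ᵈ U) ⨾ᵈ R₁.F₁ᵈ (counitᵈ U)
      ≡⟨ ⨾ᵈ-cong refl (pathOver⇒≈ (zagᵈ U)) ⟩
    _ , φ ⨾ᵈ idᵈ
      ≡⟨ idʳ≈ φ ⟩
    _ , φ
      ∎

  Lam-extᵈ-unit : ∀ {A B C} {f : Hom (A ⊗₀ B) (R₀.F₀ C)} {S : Ob[ A ]} {T : Ob[ B ]}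
                  {U : Displayed.Ob[_] q C} (φ : Hom[ f ] (S ⊗ᵈ T) (R₁.F₀ᵈ U)) →
                  unitᵈ T ⨾ᵈ Lam (extᵈ φ) ≈ Lam φ
  Lam-extᵈ-unit φ = begin
    _ , unitᵈ _ ⨾ᵈ Lam (extᵈ φ)           ≡⟨ Lam-natural _ _ ⟩
    _ , Lam ((idᵈ ⊗₁ᵈ unitᵈ _) ⨾ᵈ extᵈ φ) ≡⟨ Lam-cong (extᵈ-unit φ) ⟩
    _ , Lam φ                             ∎

-- ξ = λ(ext evʳ) and ξ_{T,U} = Λ(extᵈ evrᵈ); both unit laws are instances
-- of the extension lemmas with f = evʳ (note shift = λ evʳ by definition).
mainTheorem2 : ∀ {o₁ ℓ₁ o₂ ℓ₂ o₁' ℓ₁' o₂' ℓ₂' : Level}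
    {I : Category o₁ ℓ₁} {MI : Monoidal I} {CI : Closed MI}
    (p : MonoidalClosedFibration CI o₁' ℓ₁')
    {J : Category o₂ ℓ₂} (q : Displayed J o₂' ℓ₂')
    (LR : TRSAdjunction (MonoidalClosedFibration.E p) q)
    (SM : StrongMonadOn p LR) →
    let open Category I
        open Monoidal MI
        open Closed CI
        open MonoidalClosedFibration p
        open Displayed E
        open DispMonoidal ME
        open DispClosed CE
        open TRSAdjunction LR
        module L₀ = Functor L₀
        module R₀ = Functor R₀
        module L₁ = DispFunctor L₁
        module R₁ = DispFunctor R₁
        open Adjunction adj₀
        open DispAdjunction adj₁
    in ∀ {B : Obj} {C : Category.Obj J} (T : Ob[ B ]) (U : Displayed.Ob[_] q C) →
       Σ[ ξ ∈ Hom (R₀.F₀ (L₀.F₀ B)) ((R₀.F₀ C ⟜ B) ⊸ R₀.F₀ C) ]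
       Σ[ e ∈ unit B ⨾ ξ ≡ shift B (R₀.F₀ C) ]
       Σ[ ξTU ∈ Hom[ ξ ] (R₁.F₀ᵈ (L₁.F₀ᵈ T)) ((R₁.F₀ᵈ U ⟜ᵈ T) ⊸ᵈ R₁.F₀ᵈ U) ]
         PathOver (λ h → Hom[ h ] T ((R₁.F₀ᵈ U ⟜ᵈ T) ⊸ᵈ R₁.F₀ᵈ U)) e
                  (unitᵈ T ⨾ᵈ ξTU) (Lam (evrᵈ {U = R₁.F₀ᵈ U} {T = T}))
mainTheorem2 {CI = CI} p q LR SM T U =
    lam (ext evr)
  , lam-ext-unit evr
  , Lam (extᵈ evrᵈ)
  , ≈⇒pathOver (lam-ext-unit evr) (Lam-extᵈ-unit evrᵈ)
  where
    open Closed CI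
    open DispClosed (MonoidalClosedFibration.CE p)
    open TotalEquality (MonoidalClosedFibration.E p)
    open StrongExtension p q LR SM
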